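{- For all positive integers $n,m$, the $(n\times m)$-King's graph $G$ satisfies $\mathrm{tww}(G)\le 7$.
   Context: The $(n\times m)$-King's graph has vertex set $\{1,\dots,n\}\times\{1,\dots,m\}$, with distinct vertices $(i,j),(i',j')$ adjacent iff $|i-i'|\le 1$ and $|j-j'|\le 1$ (equivalently, it is the strong product of the paths $P_n$ and $P_m$). Twin-width: a trigraph is a vertex set with two disjoint sets of edges, black and red. Contracting two distinct vertices $u,v$ replaces them by a new vertex $w$; each $x\ne u,v$ adjacent to exactly one of $u,v$ is joined to $w$ by a red edge; each $x$ adjacent to both is joined to $w$ by a black edge if $ux,vx$ are both black and by a red edge otherwise; other edges are unchanged. A simple graph is a trigraph with no red edges. A $d$-sequence for an $N$-vertex graph $G$ is a sequence $G=G_N,\dots,G_1$ of trigraphs, each obtained from the previous by one contraction, with every vertex of every $G_i$ incident to at most $d$ red edges; $\mathrm{tww}(G)$ is the least such $d$. -}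

module Defs where

open import Data.Nat using (ℕ; zero; suc; _*_; _≤_; _≤?_; ∣_-_∣)
open import Data.Fin using (Fin; toℕ; remQuot; _≟_)
open import Data.Fin.Properties using () renaming (_≟_ to _≟ᶠ_)
open import Data.List using (length; filter)
open import Data.List using () renaming (allFin to allFinL)
open import Data.Product using (Σ; _×_; _,_; proj₁; proj₂)
open import Data.Sum using (_⊎_)
open import Relation.Nullary using (¬_; Dec; yes; no)
open import Relation.Nullary.Decidable using (_×-dec_)
open import Relation.Binary.PropositionalEquality using (_≡_; _≢_)

data Edge : Set where
  none black red : Edge

_≟ₑ_ : (a b : Edge) → Dec (a ≡ b)
none  ≟ₑ none  = yes Relation.Binary.PropositionalEquality.refl
black ≟ₑ black = yes Relation.Binary.PropositionalEquality.refl
red   ≟ₑ red   = yes Relation.Binary.PropositionalEquality.refl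
none  ≟ₑ black = no λ ()
none  ≟ₑ red   = no λ ()
black ≟ₑ none  = no λ ()
black ≟ₑ red   = no λ ()
red   ≟ₑ none  = no λ ()
red   ≟ₑ black = no λ ()

Trigraph : ℕ → Set
Trigraph k = Fin k → Fin k → Edge

IsTrigraph : ∀ {k} → Trigraph k → Set
IsTrigraph {k} E = (∀ x y → E x y ≡ E y x) × (∀ x → E x x ≡ none)

IsGraph : ∀ {k} → Trigraph k → Set
IsGraph {k} E = IsTrigraph E × (∀ x y → E x y ≢ red)

-- Edge between the contracted vertex w and x, given the edges ux and vx:
-- no edge if x is adjacent to neither; red if adjacent to exactly one;
-- if adjacent to both, black iff both edges are black, red otherwise.
merge : Edge → Edge → Edge
merge none  none  = none
merge black black = black
merge _     _     = red

-- Contraction of two distinct vertices u, v of a trigraph E on Fin (suc k)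
-- yields the trigraph E' on Fin k (up to relabelling of vertices):
-- φ sends u and v to the new vertex w = φ u = φ v and is a bijection from
-- the other vertices onto the remaining vertices of E'.
Contraction : ∀ {k} → Trigraph (suc k) → Trigraph k → Set
Contraction {k} E E' =
  Σ (Fin (suc k)) λ u → Σ (Fin (suc k)) λ v → Σ (Fin (suc k) → Fin k) λ φ →
    u ≢ v
  × φ u ≡ φ v
  × (∀ x y → φ x ≡ φ y → x ≡ y ⊎ ((x ≡ u ⊎ x ≡ v) × (y ≡ u ⊎ y ≡ v)))
  × (∀ z → Σ (Fin (suc k)) λ x → φ x ≡ z)
  × (∀ x y → x ≢ u → x ≢ v → y ≢ u → y ≢ v → E' (φ x) (φ y) ≡ E x y)
  × (∀ x → x ≢ u → x ≢ v → E' (φ u) (φ x) ≡ merge (E u x) (E v x))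

redDegree : ∀ {k} → Trigraph k → Fin k → ℕ
redDegree {k} E x = length (filter (λ y → E x y ≟ₑ red) (allFinL k))

RedBounded : ∀ {k} → ℕ → Trigraph k → Set
RedBounded {k} d E = ∀ x → redDegree E x ≤ d

data DSequence (d : ℕ) : ∀ {k} → Trigraph k → Set where
  last : (E : Trigraph 1) → IsTrigraph E → RedBounded d E → DSequence d E
  step : ∀ {k} (E : Trigraph (suc (suc k))) (E' : Trigraph (suc k)) →
         IsTrigraph E → RedBounded d E → Contraction E E' →
         DSequence d E' → DSequence d E

TwwAtMost : ∀ {k} → Trigraph k → ℕ → Set
TwwAtMost E d = DSequence d E

-- King's graph on n × m vertices.  Vertex set Fin (n * m), identified with
-- Fin n × Fin m via remQuot (the standard bijection, i * m + j ↦ (i , j)).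

Adj : ∀ n m → Fin (n * m) → Fin (n * m) → Set
Adj n m x y =
  ¬ (x ≡ y)
  × (∣ toℕ (proj₁ (remQuot {n} m x)) - toℕ (proj₁ (remQuot {n} m y)) ∣ ≤ 1)
  × (∣ toℕ (proj₂ (remQuot {n} m x)) - toℕ (proj₂ (remQuot {n} m y)) ∣ ≤ 1)

adj? : ∀ n m x y → Dec (Adj n m x y)
adj? n m x y with x ≟ᶠ y
... | yes p = no λ q → proj₁ q p
... | no ¬p with (∣ toℕ (proj₁ (remQuot {n} m x)) - toℕ (proj₁ (remQuot {n} m y)) ∣ ≤? 1)
                  ×-dec (∣ toℕ (proj₂ (remQuot {n} m x)) - toℕ (proj₂ (remQuot {n} m y)) ∣ ≤? 1)
...   | yes (a , b) = yes (¬p , a , b)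
...   | no ¬ab = no λ q → ¬ab (proj₁ (proj₂ q) , proj₂ (proj₂ q))

King : ∀ n m → Trigraph (n * m)
King n m x y with adj? n m x y
... | yes _ = black
... | no _  = none

{-# OPTIONS --safe #-}
-- Contracting a partition of a graph part by part always produces its quotient trigraph: two parts
-- are joined black if completely adjacent, not at all if completely non-adjacent, and red otherwise.
-- A contraction sequence is therefore a chain of partitions, each merging two parts of the next
-- finer one, and its width is the largest red degree of these quotients.
-- Number the cells of the board row by row and repeatedly merge the last remaining cell into the
-- cell above it, or into its left neighbour once only the first row is left.  While at least m cells
-- remain, every part is a single cell or a vertical segment running down from one of the last m
-- remaining cells; a red edge needs a segment at one of its ends and a king move between the two
-- parts, which leaves at most 6 red neighbours.  Afterwards the parts are blocks of whole columns,
-- with at most 2 red neighbours.  So the width is in fact at most 6.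

module Submission where

open import Defs
open import Data.Bool using (Bool; true; false; _∨_)
open import Data.Empty using (⊥-elim)
open import Data.Fin using (Fin; toℕ; fromℕ; fromℕ<; inject₁; lower₁; remQuot; combine)
open import Data.Fin.Properties
  using (toℕ-injective; toℕ-fromℕ; toℕ-fromℕ<; toℕ-inject₁; toℕ-lower₁; toℕ<n; any?; toℕ-combine; combine-remQuot)
  renaming (_≟_ to _≟ᶠ_)
open import Data.List using (List; []; _∷_; length; filter; map; _++_; allFin)
open import Data.List.Properties using (length-map; length-++; filter-≐)
open import Data.List.Membership.Propositional using (_∈_)
open import Data.List.Membership.Propositional.Properties using (∈-∃++; ∈-++⁻; ∈-++⁺ˡ; ∈-++⁺ʳ; ∈-map⁻; ∈-filter⁻)
open import Data.List.Relation.Binary.Subset.Propositional using (_⊆_)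
open import Data.List.Relation.Unary.Any using (here; there)
open import Data.List.Relation.Unary.All as All using ()
open import Data.List.Relation.Unary.AllPairs using (_∷_)
open import Data.List.Relation.Unary.Unique.Propositional using (Unique)
import Data.List.Relation.Unary.Unique.Propositional.Properties as Unique
open import Data.Nat
  using (ℕ; zero; suc; pred; _+_; _*_; _∸_; _≤_; _<_; z≤n; s≤s; z<s; _≟_; _≤?_; ∣_-_∣)
open import Data.Nat.Properties
open import Data.Nat.DivMod
open import Data.Nat.Divisibility using (n∣m*n)
open import Data.Product using (_×_; _,_; proj₁; proj₂; ∃; ∃₂)
import Data.Product as Product
open import Data.Sum using (_⊎_; inj₁; inj₂; [_,_])
import Data.Sum as Sum
open import Function using (_∘_; id)
open import Function.Bundles using (_⇔_; mk⇔; Equivalence)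
open import Function.Definitions using (StrictlySurjective)
open import Relation.Binary.PropositionalEquality
  using (_≡_; _≢_; refl; sym; trans; cong; cong₂; subst; subst₂; module ≡-Reasoning)
open import Relation.Nullary using (¬_; Dec; yes; no; does; contradiction; ¬?)
open import Relation.Nullary.Decidable using (_×-dec_; _⊎-dec_; dec-true; dec-false; does-⇔)
open import Relation.Unary using (Decidable)

open Equivalence using (to; from)

unique-length≤ : ∀ {A : Set} {xs ys : List A} → Unique xs → xs ⊆ ys → length xs ≤ length ys
unique-length≤ {xs = []} _ _ = z≤n
unique-length≤ {xs = x ∷ xs} (x∉xs ∷ xs-unique) xs⊆ys with ∈-∃++ (xs⊆ys (here refl))
... | zs , ws , refl = begin
  suc (length xs)             ≤⟨ s≤s (unique-length≤ xs-unique xs⊆zs++ws) ⟩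
  suc (length (zs ++ ws))     ≡⟨ cong suc (length-++ zs) ⟩
  suc (length zs + length ws) ≡⟨ +-suc (length zs) (length ws) ⟨
  length zs + length (x ∷ ws) ≡⟨ length-++ zs ⟨
  length (zs ++ x ∷ ws)       ∎
  where
  open ≤-Reasoning
  xs⊆zs++ws : xs ⊆ zs ++ ws
  xs⊆zs++ws {y} y∈xs with ∈-++⁻ zs (xs⊆ys (there y∈xs))
  ... | inj₁ y∈zs        = ∈-++⁺ˡ y∈zs
  ... | inj₂ (here refl) = ⊥-elim (All.lookup x∉xs y∈xs refl)
  ... | inj₂ (there y∈ws) = ∈-++⁺ʳ zs y∈ws

filter-allFin-length≤ : ∀ k {P : Fin k → Set} (P? : Decidable P) (ys : List ℕ) →
                        (∀ i → P i → toℕ i ∈ ys) → length (filter P? (allFin k)) ≤ length ys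
filter-allFin-length≤ k P? ys P⇒∈ = begin
  length (filter P? (allFin k))            ≡⟨ length-map toℕ (filter P? (allFin k)) ⟨
  length (map toℕ (filter P? (allFin k)))  ≤⟨ unique-length≤ unique ⊆ys ⟩
  length ys                                ∎
  where
  open ≤-Reasoning
  unique : Unique (map toℕ (filter P? (allFin k)))
  unique = Unique.map⁺ toℕ-injective (Unique.filter⁺ P? (Unique.allFin⁺ k))
  ⊆ys : map toℕ (filter P? (allFin k)) ⊆ ys
  ⊆ys y∈ with ∈-map⁻ toℕ y∈
  ... | i , i∈ , refl = P⇒∈ i (proj₂ (∈-filter⁻ P? {xs = allFin k} i∈))

∣-∣≤1⇒ : ∀ a b → ∣ a - b ∣ ≤ 1 → a ≡ b ⊎ a ≡ suc b ⊎ b ≡ suc a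
∣-∣≤1⇒ zero          zero          _       = inj₁ refl
∣-∣≤1⇒ zero          (suc zero)    _       = inj₂ (inj₂ refl)
∣-∣≤1⇒ (suc zero)    zero          _       = inj₂ (inj₁ refl)
∣-∣≤1⇒ zero          (suc (suc b)) (s≤s ())
∣-∣≤1⇒ (suc (suc a)) zero          (s≤s ())
∣-∣≤1⇒ (suc a)       (suc b)       a-b≤1 =
  Sum.map (cong suc) (Sum.map (cong suc) (cong suc)) (∣-∣≤1⇒ a b a-b≤1)

∣-∣≤1⇒≤suc : ∀ a b → ∣ a - b ∣ ≤ 1 → a ≤ suc b
∣-∣≤1⇒≤suc a b a-b≤1 with ∣-∣≤1⇒ a b a-b≤1
... | inj₁ refl        = n≤1+n a
... | inj₂ (inj₁ refl) = ≤-refl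
... | inj₂ (inj₂ refl) = ≤-trans (n≤1+n a) (n≤1+n (suc a))

∣-∣≤1⇒pred⊎≡⊎suc : ∀ a b → ∣ a - b ∣ ≤ 1 → b ≡ pred a ⊎ b ≡ a ⊎ b ≡ suc a
∣-∣≤1⇒pred⊎≡⊎suc a b a-b≤1 with ∣-∣≤1⇒ a b a-b≤1
... | inj₁ a≡b          = inj₂ (inj₁ (sym a≡b))
... | inj₂ (inj₁ a≡b+1) = inj₁ (sym (cong pred a≡b+1))
... | inj₂ (inj₂ b≡a+1) = inj₂ (inj₂ b≡a+1)

∣-∣≤1-comm : ∀ a b → ∣ a - b ∣ ≤ 1 → ∣ b - a ∣ ≤ 1
∣-∣≤1-comm a b = subst (_≤ 1) (∣-∣-comm a b)

black-or-none : ∀ {e} → e ≢ red → e ≡ black ⊎ e ≡ none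
black-or-none {none}  _    = inj₂ refl
black-or-none {black} _    = inj₁ refl
black-or-none {red}   e≢red = contradiction refl e≢red

-- The colour of the pair of parts of a graph in a quotient trigraph; the flags record whether
-- there is an edge, resp. a non-edge, between the two parts.
colour : Bool → Bool → Edge
colour false _     = none
colour true  false = black
colour true  true  = red

colour≡red⇒ : ∀ b n → colour b n ≡ red → b ≡ true × n ≡ true
colour≡red⇒ true  true  _ = refl , refl
colour≡red⇒ false _     ()
colour≡red⇒ true  false ()

colour-∨ : ∀ b₁ n₁ b₂ n₂ → b₁ ∨ n₁ ≡ true → b₂ ∨ n₂ ≡ true →
           colour (b₁ ∨ b₂) (n₁ ∨ n₂) ≡ merge (colour b₁ n₁) (colour b₂ n₂)
colour-∨ false false _     _     ()
colour-∨ _     _     false false _  ()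
colour-∨ false true  false true  _  _ = refl
colour-∨ false true  true  false _  _ = refl
colour-∨ false true  true  true  _  _ = refl
colour-∨ true  false false true  _  _ = refl
colour-∨ true  false true  false _  _ = refl
colour-∨ true  false true  true  _  _ = refl
colour-∨ true  true  false true  _  _ = refl
colour-∨ true  true  true  false _  _ = refl
colour-∨ true  true  true  true  _  _ = refl

does≡true⇒ : ∀ {A : Set} (a? : Dec A) → does a? ≡ true → A
does≡true⇒ (yes a) _ = a
does≡true⇒ (no _)  ()

module _ {k : ℕ} {E E′ : Trigraph k} (E≗E′ : ∀ x y → E x y ≡ E′ x y) where

  isTrigraph-resp : IsTrigraph E′ → IsTrigraph E
  isTrigraph-resp (symmetric , irreflexive) =
      (λ x y → trans (E≗E′ x y) (trans (symmetric x y) (sym (E≗E′ y x))))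
    , (λ x → trans (E≗E′ x x) (irreflexive x))

  redBounded-resp : ∀ {d} → RedBounded d E′ → RedBounded d E
  redBounded-resp bounded x = subst (_≤ _) (cong length (sym same-red)) (bounded x)
    where
    same-red : filter (λ y → E x y ≟ₑ red) (allFin k) ≡ filter (λ y → E′ x y ≟ₑ red) (allFin k)
    same-red = filter-≐ (λ y → E x y ≟ₑ red) (λ y → E′ x y ≟ₑ red)
                 ((λ {y} → trans (sym (E≗E′ x y))) , (λ {y} → trans (E≗E′ x y))) (allFin k)

contraction-respˡ : ∀ {k} {E E′ : Trigraph (suc k)} {F : Trigraph k} →
                    (∀ x y → E x y ≡ E′ x y) → Contraction E′ F → Contraction E F
contraction-respˡ E≗E′ (u , v , φ , u≢v , φu≡φv , φ-merges , φ-onto , unchanged , merged) =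
  u , v , φ , u≢v , φu≡φv , φ-merges , φ-onto ,
  (λ x y x≢u x≢v y≢u y≢v → trans (unchanged x y x≢u x≢v y≢u y≢v) (sym (E≗E′ x y))) ,
  (λ x x≢u x≢v → trans (merged x x≢u x≢v) (sym (cong₂ merge (E≗E′ u x) (E≗E′ v x))))

record Merging {k : ℕ} (φ : Fin (suc k) → Fin k) : Set where
  field
    u v      : Fin (suc k)
    u≢v      : u ≢ v
    φu≡φv    : φ u ≡ φ v
    φ-merges : ∀ x y → φ x ≡ φ y → x ≡ y ⊎ ((x ≡ u ⊎ x ≡ v) × (y ≡ u ⊎ y ≡ v))
    φ-onto   : StrictlySurjective _≡_ φ

redirect : ℕ → ℕ → ℕ → ℕ
redirect s t y with s ≟ y
... | yes _ = t
... | no _  = y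

redirect-self : ∀ s t → redirect s t s ≡ t
redirect-self s t with s ≟ s
... | yes _   = refl
... | no s≢s  = contradiction refl s≢s

redirect-other : ∀ {s} t {y} → y ≢ s → redirect s t y ≡ y
redirect-other {s} t {y} y≢s with s ≟ y
... | yes s≡y = contradiction (sym s≡y) y≢s
... | no _    = refl

redirect-cases : ∀ s t y → (y ≡ s × redirect s t y ≡ t) ⊎ (y ≢ s × redirect s t y ≡ y)
redirect-cases s t y with y ≟ s
... | yes refl = inj₁ (refl , redirect-self s t)
... | no y≢s   = inj₂ (y≢s , redirect-other t y≢s)

redirect-< : ∀ {s t y} → t < s → y ≤ s → redirect s t y < s
redirect-< {s} {t} {y} t<s y≤s with redirect-cases s t y
... | inj₁ (_ , r≡t)   = subst (_< s) (sym r≡t) t<s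
... | inj₂ (y≢s , r≡y) = subst (_< s) (sym r≡y) (≤∧≢⇒< y≤s y≢s)

redirect-collision : ∀ s t a b → redirect s t a ≡ redirect s t b →
                     a ≡ b ⊎ ((a ≡ t ⊎ a ≡ s) × (b ≡ t ⊎ b ≡ s))
redirect-collision s t a b ra≡rb with redirect-cases s t a | redirect-cases s t b
... | inj₁ (a≡s , _)  | inj₁ (b≡s , _)  = inj₁ (trans a≡s (sym b≡s))
... | inj₁ (a≡s , ra) | inj₂ (_ , rb)   = inj₂ (inj₂ a≡s , inj₁ (trans (sym rb) (trans (sym ra≡rb) ra)))
... | inj₂ (_ , ra)   | inj₁ (b≡s , rb) = inj₂ (inj₁ (trans (sym ra) (trans ra≡rb rb)) , inj₂ b≡s)
... | inj₂ (_ , ra)   | inj₂ (_ , rb)   = inj₁ (trans (sym ra) (trans ra≡rb rb))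

mergeLastInto : ∀ {s} → Fin s → Fin (suc s) → Fin s
mergeLastInto {s} t x with s ≟ toℕ x
... | yes _   = t
... | no s≢x  = lower₁ x s≢x

toℕ-mergeLastInto : ∀ {s} (t : Fin s) x → toℕ (mergeLastInto t x) ≡ redirect s (toℕ t) (toℕ x)
toℕ-mergeLastInto {s} t x with s ≟ toℕ x
... | yes _   = refl
... | no s≢x  = toℕ-lower₁ x s≢x

mergeLastInto-merging : ∀ {s} (t : Fin s) → Merging (mergeLastInto t)
mergeLastInto-merging {s} t = record
  { u        = inject₁ t
  ; v        = fromℕ s
  ; u≢v      = λ u≡v → <⇒≢ (toℕ<n t) (trans (sym (toℕ-inject₁ t)) (trans (cong toℕ u≡v) (toℕ-fromℕ s)))
  ; φu≡φv    = toℕ-injective (begin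
      toℕ (φ (inject₁ t))               ≡⟨ toℕ-mergeLastInto t (inject₁ t) ⟩
      redirect s (toℕ t) (toℕ (inject₁ t)) ≡⟨ cong (redirect s (toℕ t)) (toℕ-inject₁ t) ⟩
      redirect s (toℕ t) (toℕ t)        ≡⟨ redirect-other (toℕ t) (<⇒≢ (toℕ<n t)) ⟩
      toℕ t                             ≡⟨ redirect-self s (toℕ t) ⟨
      redirect s (toℕ t) s              ≡⟨ cong (redirect s (toℕ t)) (toℕ-fromℕ s) ⟨
      redirect s (toℕ t) (toℕ (fromℕ s)) ≡⟨ toℕ-mergeLastInto t (fromℕ s) ⟨
      toℕ (φ (fromℕ s))                 ∎)
  ; φ-merges = merges
  ; φ-onto   = λ z → inject₁ z , toℕ-injective (begin
      toℕ (φ (inject₁ z))                  ≡⟨ toℕ-mergeLastInto t (inject₁ z) ⟩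
      redirect s (toℕ t) (toℕ (inject₁ z)) ≡⟨ cong (redirect s (toℕ t)) (toℕ-inject₁ z) ⟩
      redirect s (toℕ t) (toℕ z)           ≡⟨ redirect-other (toℕ t) (<⇒≢ (toℕ<n z)) ⟩
      toℕ z                                ∎)
  }
  where
  open ≡-Reasoning
  φ : Fin (suc s) → Fin s
  φ = mergeLastInto t
  is-u : ∀ {x} → toℕ x ≡ toℕ t → x ≡ inject₁ t
  is-u x≡t = toℕ-injective (trans x≡t (sym (toℕ-inject₁ t)))
  is-v : ∀ {x} → toℕ x ≡ s → x ≡ fromℕ s
  is-v x≡s = toℕ-injective (trans x≡s (sym (toℕ-fromℕ s)))
  is-u-or-v : ∀ {x} → toℕ x ≡ toℕ t ⊎ toℕ x ≡ s → x ≡ inject₁ t ⊎ x ≡ fromℕ s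
  is-u-or-v = Sum.map is-u is-v
  merges : ∀ x y → φ x ≡ φ y → x ≡ y ⊎ ((x ≡ inject₁ t ⊎ x ≡ fromℕ s) × (y ≡ inject₁ t ⊎ y ≡ fromℕ s))
  merges x y φx≡φy =
    Sum.map toℕ-injective (Product.map is-u-or-v is-u-or-v)
      (redirect-collision s (toℕ t) (toℕ x) (toℕ y)
        (trans (sym (toℕ-mergeLastInto t x)) (trans (cong toℕ φx≡φy) (toℕ-mergeLastInto t y))))

module Quotient {N : ℕ} (G : Trigraph N) where

  Joined : ∀ {k} → (Fin N → Fin k) → Edge → Fin k → Fin k → Set
  Joined p e α β = ∃₂ λ x y → p x ≡ α × p y ≡ β × G x y ≡ e

  Linked : ∀ {k} → (Fin N → Fin k) → Edge → Fin k → Fin k → Set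
  Linked p e α β = α ≢ β × Joined p e α β

  linked? : ∀ {k} (p : Fin N → Fin k) e α β → Dec (Linked p e α β)
  linked? p e α β =
    ¬? (α ≟ᶠ β) ×-dec any? λ x → any? λ y → p x ≟ᶠ α ×-dec p y ≟ᶠ β ×-dec G x y ≟ₑ e

  quotient : ∀ {k} → (Fin N → Fin k) → Trigraph k
  quotient p α β = colour (does (linked? p black α β)) (does (linked? p none α β))

  quotient-isTrigraph : (∀ x y → G x y ≡ G y x) → ∀ {k} (p : Fin N → Fin k) → IsTrigraph (quotient p)
  quotient-isTrigraph G-sym p =
      (λ α β → cong₂ colour (does-⇔ linked-comm (linked? p black α β) (linked? p black β α))
                            (does-⇔ linked-comm (linked? p none α β) (linked? p none β α)))
    , (λ α → cong (λ b → colour b (does (linked? p none α α)))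
                  (dec-false (linked? p black α α) (λ l → proj₁ l refl)))
    where
    linked-sym : ∀ {e α β} → Linked p e α β → Linked p e β α
    linked-sym (α≢β , x , y , px , py , Gxy) = α≢β ∘ sym , y , x , py , px , trans (G-sym y x) Gxy
    linked-comm : ∀ {e α β} → Linked p e α β ⇔ Linked p e β α
    linked-comm = mk⇔ linked-sym linked-sym

  quotient-red⇒ : ∀ {k} (p : Fin N → Fin k) α β → quotient p α β ≡ red →
                  Linked p black α β × Linked p none α β
  quotient-red⇒ p α β q = Product.map (does≡true⇒ (linked? p black α β)) (does≡true⇒ (linked? p none α β))
                            (colour≡red⇒ _ _ q)

  linked-of-id : ∀ {p : Fin N → Fin N} → (∀ x → p x ≡ x) → ∀ {e α β} → Linked p e α β → G α β ≡ e
  linked-of-id p≗id (_ , x , y , px , py , Gxy) =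
    subst₂ (λ a b → G a b ≡ _) (trans (sym (p≗id x)) px) (trans (sym (p≗id y)) py) Gxy

  quotient-of-id : IsGraph G → (p : Fin N → Fin N) → (∀ x → p x ≡ x) → ∀ α β → G α β ≡ quotient p α β
  quotient-of-id ((_ , G-irrefl) , G-no-red) p p≗id α β with black-or-none (G-no-red α β)
  ... | inj₁ Gαβ≡black = trans Gαβ≡black (sym (cong₂ colour
          (dec-true (linked? p black α β) (α≢β , α , β , p≗id α , p≗id β , Gαβ≡black))
          (dec-false (linked? p none α β) λ l → black≢none (trans (sym Gαβ≡black) (linked-of-id p≗id l)))))
    where
    black≢none : black ≢ none
    black≢none ()
    α≢β : α ≢ β
    α≢β refl = black≢none (trans (sym Gαβ≡black) (G-irrefl α))
  ... | inj₂ Gαβ≡none = trans Gαβ≡none (sym (cong (λ b → colour b (does (linked? p none α β)))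
          (dec-false (linked? p black α β) λ l → none≢black (trans (sym Gαβ≡none) (linked-of-id p≗id l)))))
    where
    none≢black : none ≢ black
    none≢black ()

  module _ (G-graph : IsGraph G) {k} {p : Fin N → Fin (suc k)} (p-onto : StrictlySurjective _≡_ p)
           {φ : Fin (suc k) → Fin k} (M : Merging φ) {p′ : Fin N → Fin k} (p′≗φ∘p : ∀ z → p′ z ≡ φ (p z))
           where
    open Merging M

    φ-injective-off : ∀ {x y} → x ≢ u → x ≢ v → φ x ≡ φ y → x ≡ y
    φ-injective-off {x} {y} x≢u x≢v φx≡φy with φ-merges x y φx≡φy
    ... | inj₁ x≡y             = x≡y
    ... | inj₂ (inj₁ x≡u , _)  = contradiction x≡u x≢u
    ... | inj₂ (inj₂ x≡v , _)  = contradiction x≡v x≢v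

    fibre-unmerged : ∀ {x} z → x ≢ u → x ≢ v → p′ z ≡ φ x ⇔ p z ≡ x
    fibre-unmerged z x≢u x≢v = mk⇔
      (λ p′z≡φx → sym (φ-injective-off x≢u x≢v (sym (trans (sym (p′≗φ∘p z)) p′z≡φx))))
      (λ pz≡x → trans (p′≗φ∘p z) (cong φ pz≡x))

    fibre-merged : ∀ z → p′ z ≡ φ u ⇔ (p z ≡ u ⊎ p z ≡ v)
    fibre-merged z = mk⇔ into
      [ (λ pz≡u → trans (p′≗φ∘p z) (cong φ pz≡u)) , (λ pz≡v → trans (p′≗φ∘p z) (trans (cong φ pz≡v) (sym φu≡φv))) ]
      where
      into : p′ z ≡ φ u → p z ≡ u ⊎ p z ≡ v
      into p′z≡φu with φ-merges (p z) u (trans (sym (p′≗φ∘p z)) p′z≡φu)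
      ... | inj₁ pz≡u              = inj₁ pz≡u
      ... | inj₂ (pz≡u-or-v , _)   = pz≡u-or-v

    linked-unmerged : ∀ e {x y} → x ≢ u → x ≢ v → y ≢ u → y ≢ v → Linked p′ e (φ x) (φ y) ⇔ Linked p e x y
    linked-unmerged e x≢u x≢v y≢u y≢v = mk⇔
      (λ (φx≢φy , a , b , pa , pb , Gab) →
        (λ x≡y → φx≢φy (cong φ x≡y)) , a , b , to (fibre-unmerged a x≢u x≢v) pa , to (fibre-unmerged b y≢u y≢v) pb , Gab)
      (λ (x≢y , a , b , pa , pb , Gab) →
        (λ φx≡φy → x≢y (φ-injective-off x≢u x≢v φx≡φy)) , a , b , from (fibre-unmerged a x≢u x≢v) pa , from (fibre-unmerged b y≢u y≢v) pb , Gab)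

    linked-merged : ∀ e {x} → x ≢ u → x ≢ v → Linked p′ e (φ u) (φ x) ⇔ (Linked p e u x ⊎ Linked p e v x)
    linked-merged e {x} x≢u x≢v = mk⇔ into outof
      where
      φu≢φx : φ u ≢ φ x
      φu≢φx φu≡φx = x≢u (φ-injective-off x≢u x≢v (sym φu≡φx))
      into : Linked p′ e (φ u) (φ x) → Linked p e u x ⊎ Linked p e v x
      into (_ , a , b , pa , pb , Gab) with to (fibre-merged a) pa
      ... | inj₁ pa≡u = inj₁ (x≢u ∘ sym , a , b , pa≡u , to (fibre-unmerged b x≢u x≢v) pb , Gab)
      ... | inj₂ pa≡v = inj₂ (x≢v ∘ sym , a , b , pa≡v , to (fibre-unmerged b x≢u x≢v) pb , Gab)
      outof : Linked p e u x ⊎ Linked p e v x → Linked p′ e (φ u) (φ x)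
      outof (inj₁ (_ , a , b , pa , pb , Gab)) =
        φu≢φx , a , b , from (fibre-merged a) (inj₁ pa) , from (fibre-unmerged b x≢u x≢v) pb , Gab
      outof (inj₂ (_ , a , b , pa , pb , Gab)) =
        φu≢φx , a , b , from (fibre-merged a) (inj₂ pa) , from (fibre-unmerged b x≢u x≢v) pb , Gab

    -- An empty part would be coloured none, which is not neutral for merge; hence p must be onto.
    linked-black-or-none : ∀ {α β} → α ≢ β → does (linked? p black α β) ∨ does (linked? p none α β) ≡ true
    linked-black-or-none {α} {β} α≢β with p-onto α | p-onto β
    ... | x , px | y , py =
      dec-true (linked? p black α β ⊎-dec linked? p none α β)
        (Sum.map (λ Gxy → α≢β , x , y , px , py , Gxy) (λ Gxy → α≢β , x , y , px , py , Gxy)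
                 (black-or-none (proj₂ G-graph x y)))

    quotient-contraction : Contraction (quotient p) (quotient p′)
    quotient-contraction = u , v , φ , u≢v , φu≡φv , φ-merges , φ-onto , unchanged , merged
      where
      unchanged : ∀ x y → x ≢ u → x ≢ v → y ≢ u → y ≢ v → quotient p′ (φ x) (φ y) ≡ quotient p x y
      unchanged x y x≢u x≢v y≢u y≢v =
        cong₂ colour (does-⇔ (linked-unmerged black x≢u x≢v y≢u y≢v) (linked? p′ black (φ x) (φ y)) (linked? p black x y))
                     (does-⇔ (linked-unmerged none x≢u x≢v y≢u y≢v) (linked? p′ none (φ x) (φ y)) (linked? p none x y))
      merged : ∀ x → x ≢ u → x ≢ v → quotient p′ (φ u) (φ x) ≡ merge (quotient p u x) (quotient p v x)
      merged x x≢u x≢v = trans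
        (cong₂ colour (does-⇔ (linked-merged black x≢u x≢v) (linked? p′ black (φ u) (φ x)) (linked? p black u x ⊎-dec linked? p black v x))
                      (does-⇔ (linked-merged none x≢u x≢v) (linked? p′ none (φ u) (φ x)) (linked? p none u x ⊎-dec linked? p none v x)))
        (colour-∨ _ _ _ _ (linked-black-or-none (x≢u ∘ sym)) (linked-black-or-none (x≢v ∘ sym)))

module _ {N′ : ℕ} (G : Trigraph (suc N′)) (G-graph : IsGraph G) (d : ℕ)
         (part : ∀ k → Fin (suc N′) → Fin (suc k))
         (part-top : ∀ x → part N′ x ≡ x)
         (part-step : ∀ k → suc k ≤ N′ →
                      ∃ λ (φ : Fin (suc (suc k)) → Fin (suc k)) → Merging φ × (∀ x → part k x ≡ φ (part (suc k) x)))
         (part-redBounded : ∀ k → k ≤ N′ → RedBounded d (Quotient.quotient G (part k)))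
         where
  open Quotient G

  private
    dsequence-from : ∀ k → k ≤ N′ → StrictlySurjective _≡_ (part k) →
                     (E : Trigraph (suc k)) → (∀ α β → E α β ≡ quotient (part k) α β) → DSequence d E
    dsequence-from zero k≤N′ _ E E≗ =
      last E (isTrigraph-resp E≗ (quotient-isTrigraph (proj₁ (proj₁ G-graph)) (part 0)))
             (redBounded-resp E≗ (part-redBounded 0 k≤N′))
    dsequence-from (suc k) k<N′ onto E E≗ with part-step k k<N′
    ... | φ , M , part≗φ∘part =
      step E (quotient (part k))
           (isTrigraph-resp E≗ (quotient-isTrigraph (proj₁ (proj₁ G-graph)) (part (suc k))))
           (redBounded-resp E≗ (part-redBounded (suc k) k<N′))
           (contraction-respˡ {F = quotient (part k)} E≗ (quotient-contraction G-graph onto M part≗φ∘part))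
           (dsequence-from k (<⇒≤ k<N′) onto′ (quotient (part k)) (λ _ _ → refl))
      where
      onto′ : StrictlySurjective _≡_ (part k)
      onto′ α with Merging.φ-onto M α
      ... | β , φβ≡α with onto β
      ...   | x , px≡β = x , trans (part≗φ∘part x) (trans (cong φ px≡β) φβ≡α)

  dsequence-of-partitions : DSequence d G
  dsequence-of-partitions =
    dsequence-from N′ ≤-refl (λ α → α , part-top α) G (quotient-of-id G-graph (part N′) part-top)

Adj-sym : ∀ {n m x y} → Adj n m x y → Adj n m y x
Adj-sym {n} {m} {x} {y} (x≢y , rows , cols) =
    x≢y ∘ sym
  , ∣-∣≤1-comm (toℕ (proj₁ (remQuot {n} m x))) (toℕ (proj₁ (remQuot {n} m y))) rows
  , ∣-∣≤1-comm (toℕ (proj₂ (remQuot {n} m x))) (toℕ (proj₂ (remQuot {n} m y))) cols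

King-isGraph : ∀ n m → IsGraph (King n m)
King-isGraph n m = (symmetric , irreflexive) , no-red
  where
  symmetric : ∀ x y → King n m x y ≡ King n m y x
  symmetric x y with adj? n m x y | adj? n m y x
  ... | yes _     | yes _     = refl
  ... | no _      | no _      = refl
  ... | yes x~y   | no ¬y~x   = contradiction (Adj-sym {n} {m} {x} {y} x~y) ¬y~x
  ... | no ¬x~y   | yes y~x   = contradiction (Adj-sym {n} {m} {y} {x} y~x) ¬x~y
  irreflexive : ∀ x → King n m x x ≡ none
  irreflexive x with adj? n m x x
  ... | yes (x≢x , _) = contradiction refl x≢x
  ... | no _          = refl
  no-red : ∀ x y → King n m x y ≢ red
  no-red x y with adj? n m x y
  ... | yes _ = λ ()
  ... | no _  = λ ()

King≡black⇒Adj : ∀ {n m} x y → King n m x y ≡ black → Adj n m x y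
King≡black⇒Adj {n} {m} x y King≡black with adj? n m x y
... | yes x~y = x~y
King≡black⇒Adj x y () | no _

module KingPartitions (n′ m′ : ℕ) where

  m N′ : ℕ
  m  = suc m′
  N′ = m′ + n′ * m

  open Quotient (King (suc n′) m)

  row col : ℕ → ℕ
  row a = a / m
  col a = a % m

  cell : ℕ → ℕ → ℕ
  cell r c = c + r * m

  row-cell : ∀ r {c} → c < m → row (cell r c) ≡ r
  row-cell r {c} c<m = begin
    (c + r * m) / m    ≡⟨ +-distrib-/-∣ʳ c (n∣m*n r) ⟩
    c / m + r * m / m  ≡⟨ cong₂ _+_ (m<n⇒m/n≡0 c<m) (m*n/n≡m r m) ⟩
    r                  ∎
    where open ≡-Reasoning

  col-cell : ∀ r {c} → c < m → col (cell r c) ≡ c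
  col-cell r {c} c<m = trans ([m+kn]%n≡m%n c r m) (m<n⇒m%n≡m c<m)

  cell-row-col : ∀ a → a ≡ cell (row a) (col a)
  cell-row-col a = m≡m%n+[m/n]*n a m

  row-+m : ∀ a → row (a + m) ≡ suc (row a)
  row-+m a = trans (m/n≡1+[m∸n]/n (m≤n+m m a)) (cong (suc ∘ row) (m+n∸n≡m a m))

  col-+m : ∀ a → col (a + m) ≡ col a
  col-+m a = [m+n]%n≡m%n a m

  <⇒row<⊎col< : ∀ {a b} → a < b → row a < row b ⊎ (row a ≡ row b × col a < col b)
  <⇒row<⊎col< {a} {b} a<b with row a ≟ row b
  ... | no ra≢rb  = inj₁ (≤∧≢⇒< (/-monoˡ-≤ m (<⇒≤ a<b)) ra≢rb)
  ... | yes ra≡rb = inj₂ (ra≡rb , +-cancelʳ-< (row a * m) (col a) (col b)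
                            (subst₂ _<_ (cell-row-col a) (trans (cell-row-col b) (cong (λ r → cell r (col b)) (sym ra≡rb))) a<b))

  <+m⇒row≤⊎col< : ∀ {a b} → a < b + m → row a ≤ row b ⊎ (row a ≡ suc (row b) × col a < col b)
  <+m⇒row≤⊎col< {a} {b} a<b+m with <⇒row<⊎col< a<b+m
  ... | inj₁ ra<rb+m           = inj₁ (≤-pred (subst (row a <_) (row-+m b) ra<rb+m))
  ... | inj₂ (ra≡rb+m , ca<cb+m) = inj₂ (trans ra≡rb+m (row-+m b) , subst (col a <_) (col-+m b) ca<cb+m)

  <+m⇒row≤suc : ∀ {a b} → a < b + m → row a ≤ suc (row b)
  <+m⇒row≤suc a<b+m with <+m⇒row≤⊎col< a<b+m
  ... | inj₁ ra≤rb       = m≤n⇒m≤1+n ra≤rb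
  ... | inj₂ (ra≡rb+1 , _) = ≤-reflexive ra≡rb+1

  Near : ℕ → ℕ → Set
  Near a b = ∣ row a - row b ∣ ≤ 1 × ∣ col a - col b ∣ ≤ 1

  toℕ-remQuot : ∀ (x : Fin (suc N′)) →
                toℕ (proj₁ (remQuot {suc n′} m x)) ≡ row (toℕ x) × toℕ (proj₂ (remQuot {suc n′} m x)) ≡ col (toℕ x)
  toℕ-remQuot x =
      sym (trans (cong row x≡cell) (row-cell (toℕ i) (toℕ<n j)))
    , sym (trans (cong col x≡cell) (col-cell (toℕ i) (toℕ<n j)))
    where
    open ≡-Reasoning
    i : Fin (suc n′)
    i = proj₁ (remQuot {suc n′} m x)
    j : Fin m
    j = proj₂ (remQuot {suc n′} m x)
    x≡cell : toℕ x ≡ cell (toℕ i) (toℕ j)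
    x≡cell = begin
      toℕ x                  ≡⟨ cong toℕ (combine-remQuot {suc n′} m x) ⟨
      toℕ (combine i j)      ≡⟨ toℕ-combine i j ⟩
      m * toℕ i + toℕ j      ≡⟨ +-comm (m * toℕ i) (toℕ j) ⟩
      toℕ j + m * toℕ i      ≡⟨ cong (toℕ j +_) (*-comm m (toℕ i)) ⟩
      cell (toℕ i) (toℕ j)   ∎

  King≡black⇒Near : ∀ x y → King (suc n′) m x y ≡ black → Near (toℕ x) (toℕ y)
  King≡black⇒Near x y King≡black with King≡black⇒Adj x y King≡black
  ... | _ , rows , cols =
      subst₂ (λ a b → ∣ a - b ∣ ≤ 1) (proj₁ (toℕ-remQuot x)) (proj₁ (toℕ-remQuot y)) rows
    , subst₂ (λ a b → ∣ a - b ∣ ≤ 1) (proj₂ (toℕ-remQuot x)) (proj₂ (toℕ-remQuot y)) cols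

  target : ℕ → ℕ
  target s with m ≤? s
  ... | yes _ = s ∸ m
  ... | no _  = pred s

  target-below : ∀ {s} → m ≤ s → target s ≡ s ∸ m
  target-below {s} m≤s with m ≤? s
  ... | yes _   = refl
  ... | no m≰s  = contradiction m≤s m≰s

  target-firstRow : ∀ {s} → s < m → target s ≡ pred s
  target-firstRow {s} s<m with m ≤? s
  ... | yes m≤s = contradiction s<m (≤⇒≯ m≤s)
  ... | no _    = refl

  target< : ∀ {s} → 0 < s → target s < s
  target< {suc s} _ with m ≤? suc s
  ... | yes _ = s≤s (m∸n≤m s m′)
  ... | no _  = ≤-refl

  -- The surviving vertex whose part contains x, once the vertices k + d - 1, …, k + 1, k have been
  -- merged away in this order.
  collapse : ℕ → ℕ → ℕ → ℕ
  collapse zero    k x = x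
  collapse (suc d) k x = redirect k (target k) (collapse d (suc k) x)

  collapse-< : ∀ d {k x} → 0 < k → x < k + d → collapse d k x < k
  collapse-< zero    {k} {x} _   x<k+0 = subst (x <_) (+-identityʳ k) x<k+0
  collapse-< (suc d) {k} {x} 0<k x<k+d =
    redirect-< (target< 0<k) (≤-pred (collapse-< d z<s (subst (x <_) (+-suc k d) x<k+d)))

  collapse-id : ∀ d {k x} → x < k → collapse d k x ≡ x
  collapse-id zero    _   = refl
  collapse-id (suc d) {k} x<k =
    trans (cong (redirect k (target k)) (collapse-id d (m<n⇒m<1+n x<k))) (redirect-other (target k) (<⇒≢ x<k))

  Tail : ℕ → ℕ → Set
  Tail k a = k ≤ a + m

  Below : ℕ → ℕ → Set
  Below a x = col x ≡ col a × row a ≤ row x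

  -- Where a vertex x of part a can lie once k parts remain: TailClass while m ≤ k, ColumnClass while k ≤ m.
  TailClass : ℕ → ℕ → ℕ → Set
  TailClass k a x = x ≡ a ⊎ (Tail k a × Below a x)

  ColumnClass : ℕ → ℕ → ℕ → Set
  ColumnClass k a x = col x ≡ a ⊎ (suc a ≡ k × a ≤ col x)

  tailClass⇒below : ∀ {k a x} → TailClass k a x → Below a x
  tailClass⇒below (inj₁ refl)        = refl , ≤-refl
  tailClass⇒below (inj₂ (_ , below)) = below

  tailClass-notTail : ∀ {k a x} → ¬ Tail k a → TailClass k a x → x ≡ a
  tailClass-notTail _      (inj₁ x≡a)       = x≡a
  tailClass-notTail ¬tail  (inj₂ (tail , _)) = contradiction tail ¬tail

  below-target : ∀ {k x} → m ≤ k → Below k x → Below (k ∸ m) x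
  below-target {k} m≤k (colx≡colk , rowk≤rowx) =
      trans colx≡colk (sym (m≤n⇒[n∸m]%m≡n%m m≤k))
    , ≤-trans (/-monoˡ-≤ m (m∸n≤m k m)) rowk≤rowx

  collapse-tailClass : ∀ d {k x} → m ≤ k → TailClass k (collapse d k x) x
  collapse-tailClass zero    _ = inj₁ refl
  collapse-tailClass (suc d) {k} {x} m≤k
    with redirect-cases k (target k) (collapse d (suc k) x) | collapse-tailClass d {suc k} {x} (m≤n⇒m≤1+n m≤k)
  ... | inj₁ (b≡k , r≡t) | class =
    subst (λ a → TailClass k a x) (sym (trans r≡t (target-below m≤k)))
          (inj₂ (≤-reflexive (sym (m∸n+n≡m m≤k)) , below-target {x = x} m≤k (subst (λ a → Below a x) b≡k (tailClass⇒below class))))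
  ... | inj₂ (_ , r≡b) | class =
    subst (λ a → TailClass k a x) (sym r≡b) (Sum.map id (Product.map₁ (≤-trans (n≤1+n k))) class)

  collapse-columnClass : ∀ d {k x} → 0 < k → k ≤ m → x < k + d → ColumnClass k (collapse d k x) x
  collapse-columnClass zero {k} {x} _ k≤m x<k+0 =
    inj₁ (m<n⇒m%n≡m (≤-trans (subst (x <_) (+-identityʳ k) x<k+0) k≤m))
  collapse-columnClass (suc d) {k} {x} 0<k k≤m x<k+d with k ≟ m
  ... | yes refl = inj₁ (trans (proj₁ (tailClass⇒below (collapse-tailClass (suc d) ≤-refl)))
                               (m<n⇒m%n≡m (collapse-< (suc d) 0<k x<k+d)))
  ... | no k≢m with redirect-cases k (target k) (collapse d (suc k) x)
                  | collapse-columnClass d {suc k} {x} z<s (≤∧≢⇒< k≤m k≢m) (subst (x <_) (+-suc k d) x<k+d)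
  ...   | inj₁ (b≡k , r≡t) | class =
    subst (λ a → ColumnClass k a x) (sym (trans r≡t (target-firstRow (≤∧≢⇒< k≤m k≢m))))
          (inj₂ (suc-pred-of 0<k , ≤-trans (≤-trans pred[n]≤n (≤-reflexive (sym b≡k))) (atLeast class)))
    where
    suc-pred-of : ∀ {k} → 0 < k → suc (pred k) ≡ k
    suc-pred-of {suc k} _ = refl
    atLeast : ColumnClass (suc k) (collapse d (suc k) x) x → collapse d (suc k) x ≤ col x
    atLeast (inj₁ colx≡b)   = ≤-reflexive (sym colx≡b)
    atLeast (inj₂ (_ , b≤)) = b≤
  ...   | inj₂ (b≢k , r≡b) | class =
    subst (λ a → ColumnClass k a x) (sym r≡b) (narrow class)
    where
    narrow : ColumnClass (suc k) (collapse d (suc k) x) x → ColumnClass k (collapse d (suc k) x) x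
    narrow (inj₁ colx≡b)        = inj₁ colx≡b
    narrow (inj₂ (sb≡sk , _))  = contradiction (suc-injective sb≡sk) b≢k

  part-bound : ∀ k (x : Fin (suc N′)) → toℕ x < suc k + (N′ ∸ k)
  part-bound k x = ≤-trans (toℕ<n x) (s≤s (m≤n+m∸n N′ k))

  part : ∀ k → Fin (suc N′) → Fin (suc k)
  part k x = fromℕ< (collapse-< (N′ ∸ k) z<s (part-bound k x))

  toℕ-part : ∀ k x → toℕ (part k x) ≡ collapse (N′ ∸ k) (suc k) (toℕ x)
  toℕ-part k x = toℕ-fromℕ< _

  part-top : ∀ x → part N′ x ≡ x
  part-top x = toℕ-injective (trans (toℕ-part N′ x) (collapse-id (N′ ∸ N′) (toℕ<n x)))

  part-step : ∀ k → suc k ≤ N′ →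
              ∃ λ (φ : Fin (suc (suc k)) → Fin (suc k)) → Merging φ × (∀ x → part k x ≡ φ (part (suc k) x))
  part-step k k<N′ = mergeLastInto t , mergeLastInto-merging t , λ x → toℕ-injective (begin
    toℕ (part k x)                                   ≡⟨ toℕ-part k x ⟩
    collapse (N′ ∸ k) (suc k) (toℕ x)                ≡⟨ cong (λ d → collapse d (suc k) (toℕ x)) (+-∸-assoc 1 k<N′) ⟩
    redirect (suc k) (target (suc k)) (collapse (N′ ∸ suc k) (suc (suc k)) (toℕ x))
                                                     ≡⟨ cong₂ (redirect (suc k)) (toℕ-fromℕ< _) (toℕ-part (suc k) x) ⟨
    redirect (suc k) (toℕ t) (toℕ (part (suc k) x))  ≡⟨ toℕ-mergeLastInto t (part (suc k) x) ⟨
    toℕ (mergeLastInto t (part (suc k) x))           ∎)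
    where
    open ≡-Reasoning
    t : Fin (suc k)
    t = fromℕ< (target< {suc k} z<s)

  part-tailClass : ∀ {k x α} → m ≤ suc k → part k x ≡ α → TailClass (suc k) (toℕ α) (toℕ x)
  part-tailClass {k} {x} m≤K px≡α =
    subst (λ a → TailClass (suc k) a (toℕ x)) (trans (sym (toℕ-part k x)) (cong toℕ px≡α))
          (collapse-tailClass (N′ ∸ k) m≤K)

  part-columnClass : ∀ {k x α} → suc k ≤ m → part k x ≡ α → ColumnClass (suc k) (toℕ α) (toℕ x)
  part-columnClass {k} {x} K≤m px≡α =
    subst (λ a → ColumnClass (suc k) a (toℕ x)) (trans (sym (toℕ-part k x)) (cong toℕ px≡α))
          (collapse-columnClass (N′ ∸ k) z<s K≤m (part-bound k x))

  -- The king-neighbours of the cell (r, c) whose index is smaller than that of (r + 1, c), up to junk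
  -- entries at the border.
  precedingNeighbours : ℕ → ℕ → List ℕ
  precedingNeighbours r c =
    cell (pred r) (pred c) ∷ cell (pred r) c ∷ cell (pred r) (suc c) ∷
    cell r (pred c) ∷ cell r (suc c) ∷ cell (suc r) (pred c) ∷ []

  followingNeighbours : ℕ → ℕ → List ℕ
  followingNeighbours r c = cell r (suc c) ∷ cell (suc r) (pred c) ∷ cell (suc r) c ∷ cell (suc r) (suc c) ∷ []

  ∈-at : ∀ {b r c} {cells : List ℕ} → row b ≡ r → col b ≡ c → cell r c ∈ cells → b ∈ cells
  ∈-at {b} {cells = cells} rb≡r cb≡c = subst (_∈ cells) (sym (trans (cell-row-col b) (cong₂ cell rb≡r cb≡c)))

  rows-adjacent : ∀ {r s} → s ≤ r → r ≤ suc s → s ≡ pred r ⊎ s ≡ r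
  rows-adjacent {r} {s} s≤r r≤s+1 with s ≟ r
  ... | yes s≡r = inj₂ s≡r
  ... | no s≢r  = inj₁ (sym (cong pred (≤-antisym r≤s+1 (≤∧≢⇒< s≤r s≢r))))

  precedingNeighbours-complete : ∀ {a b} → b ≢ a → b < a + m → row a ≤ suc (row b) → ∣ col a - col b ∣ ≤ 1 →
                                 b ∈ precedingNeighbours (row a) (col a)
  precedingNeighbours-complete {a} {b} b≢a b<a+m ra≤rb+1 cols
    with <+m⇒row≤⊎col< b<a+m | ∣-∣≤1⇒pred⊎≡⊎suc (col a) (col b) cols
  ... | inj₁ rb≤ra | columns = sameOrUpperRow (rows-adjacent rb≤ra ra≤rb+1) columns
    where
    sameOrUpperRow : row b ≡ pred (row a) ⊎ row b ≡ row a →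
                     col b ≡ pred (col a) ⊎ col b ≡ col a ⊎ col b ≡ suc (col a) → b ∈ precedingNeighbours (row a) (col a)
    sameOrUpperRow (inj₁ r) (inj₁ c)        = ∈-at r c (here refl)
    sameOrUpperRow (inj₁ r) (inj₂ (inj₁ c)) = ∈-at r c (there (here refl))
    sameOrUpperRow (inj₁ r) (inj₂ (inj₂ c)) = ∈-at r c (there (there (here refl)))
    sameOrUpperRow (inj₂ r) (inj₁ c)        = ∈-at r c (there (there (there (here refl))))
    sameOrUpperRow (inj₂ r) (inj₂ (inj₁ c)) =
      contradiction (trans (cell-row-col b) (trans (cong₂ cell r c) (sym (cell-row-col a)))) b≢a
    sameOrUpperRow (inj₂ r) (inj₂ (inj₂ c)) = ∈-at r c (there (there (there (there (here refl)))))
  ... | inj₂ (rb≡ra+1 , _)  | inj₁ cb≡ca-1 = ∈-at rb≡ra+1 cb≡ca-1 (there (there (there (there (there (here refl))))))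
  ... | inj₂ (_ , cb<ca)    | inj₂ (inj₁ cb≡ca) = contradiction cb≡ca (<⇒≢ cb<ca)
  ... | inj₂ (_ , cb<ca)    | inj₂ (inj₂ cb≡ca+1) =
    contradiction cb<ca (<-asym (subst (col a <_) (sym cb≡ca+1) (n<1+n (col a))))

  followingNeighbours-complete : ∀ {a b} → a < b → row b ≤ suc (row a) → ∣ col a - col b ∣ ≤ 1 →
                                 b ∈ followingNeighbours (row a) (col a)
  followingNeighbours-complete {a} {b} a<b rb≤ra+1 cols
    with <⇒row<⊎col< a<b | ∣-∣≤1⇒pred⊎≡⊎suc (col a) (col b) cols
  ... | inj₁ ra<rb | columns = nextRow (≤-antisym rb≤ra+1 ra<rb) columns
    where
    nextRow : row b ≡ suc (row a) →
              col b ≡ pred (col a) ⊎ col b ≡ col a ⊎ col b ≡ suc (col a) → b ∈ followingNeighbours (row a) (col a)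
    nextRow r (inj₁ c)        = ∈-at r c (there (here refl))
    nextRow r (inj₂ (inj₁ c)) = ∈-at r c (there (there (here refl)))
    nextRow r (inj₂ (inj₂ c)) = ∈-at r c (there (there (there (here refl))))
  ... | inj₂ (ra≡rb , _)   | inj₂ (inj₂ cb≡ca+1) = ∈-at (sym ra≡rb) cb≡ca+1 (here refl)
  ... | inj₂ (_ , ca<cb)   | inj₂ (inj₁ cb≡ca) = contradiction (sym cb≡ca) (<⇒≢ ca<cb)
  ... | inj₂ (_ , ca<cb)   | inj₁ cb≡ca-1 =
    contradiction ca<cb (≤⇒≯ (subst (_≤ col a) (sym cb≡ca-1) pred[n]≤n))

  columnClass-neighbour : ∀ {K a b} x y → a ≢ b → a < K → b < K → ColumnClass K a x → ColumnClass K b y →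
                          ∣ col x - col y ∣ ≤ 1 → b ∈ suc a ∷ pred a ∷ []
  columnClass-neighbour x y a≢b _ _ (inj₁ cx≡a) (inj₁ cy≡b) cols with ∣-∣≤1⇒pred⊎≡⊎suc (col x) (col y) cols
  ... | inj₁ cy≡cx-1        = there (here (trans (sym cy≡b) (trans cy≡cx-1 (cong pred cx≡a))))
  ... | inj₂ (inj₁ cy≡cx)   = contradiction (trans (sym cx≡a) (trans (sym cy≡cx) cy≡b)) a≢b
  ... | inj₂ (inj₂ cy≡cx+1) = here (trans (sym cy≡b) (trans cy≡cx+1 (cong suc cx≡a)))
  columnClass-neighbour x y a≢b a<K _ (inj₁ cx≡a) (inj₂ (b+1≡K , b≤cy)) cols =
    here (≤-antisym (≤-trans b≤cy (subst (λ c → col y ≤ suc c) cx≡a (∣-∣≤1⇒≤suc (col y) (col x) (∣-∣≤1-comm (col x) (col y) cols))))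
                    (≤∧≢⇒< (≤-pred (subst (_ <_) (sym b+1≡K) a<K)) a≢b))
  columnClass-neighbour x y a≢b _ b<K (inj₂ (a+1≡K , a≤cx)) (inj₁ cy≡b) cols =
    there (here (sym (cong pred (≤-antisym (≤-trans a≤cx (subst (λ c → col x ≤ suc c) cy≡b (∣-∣≤1⇒≤suc (col x) (col y) cols)))
                                           (≤∧≢⇒< (≤-pred (subst (_ <_) (sym a+1≡K) b<K)) (a≢b ∘ sym))))))
  columnClass-neighbour _ _ a≢b _ _ (inj₂ (a+1≡K , _)) (inj₂ (b+1≡K , _)) _ =
    contradiction (suc-injective (trans a+1≡K (sym b+1≡K))) a≢b

  tailStage-red⇒tail : ∀ {k α β} → m ≤ suc k → quotient (part k) α β ≡ red → Tail (suc k) (toℕ α) ⊎ Tail (suc k) (toℕ β)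
  tailStage-red⇒tail {k} {α} {β} m≤K isRed
    with quotient-red⇒ (part k) α β isRed | suc k ≤? toℕ α + m | suc k ≤? toℕ β + m
  ... | _ | yes tailα | _         = inj₁ tailα
  ... | _ | no _      | yes tailβ = inj₂ tailβ
  ... | (_ , x , y , px , py , Gxy≡black) , (_ , x′ , y′ , px′ , py′ , Gx′y′≡none) | no ¬tailα | no ¬tailβ =
    contradiction (trans (sym Gxy≡black) (trans (cong₂ (King (suc n′) m) x≡x′ y≡y′) Gx′y′≡none)) λ ()
    where
    x≡x′ : x ≡ x′
    x≡x′ = toℕ-injective (trans (tailClass-notTail ¬tailα (part-tailClass m≤K px))
                                (sym (tailClass-notTail ¬tailα (part-tailClass m≤K px′))))
    y≡y′ : y ≡ y′
    y≡y′ = toℕ-injective (trans (tailClass-notTail ¬tailβ (part-tailClass m≤K py))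
                                (sym (tailClass-notTail ¬tailβ (part-tailClass m≤K py′))))

  tailStage-red-tail : ∀ {k α β} → m ≤ suc k → quotient (part k) α β ≡ red → Tail (suc k) (toℕ α) →
                       toℕ β ∈ precedingNeighbours (row (toℕ α)) (col (toℕ α))
  tailStage-red-tail {k} {α} {β} m≤K isRed tailα with quotient-red⇒ (part k) α β isRed
  ... | (α≢β , x , y , px , py , Gxy≡black) , _ =
    precedingNeighbours-complete (λ b≡a → α≢β (toℕ-injective (sym b≡a))) (≤-trans (toℕ<n β) tailα) rows cols
    where
    near : Near (toℕ x) (toℕ y)
    near = King≡black⇒Near x y Gxy≡black
    below-x : Below (toℕ α) (toℕ x)
    below-x = tailClass⇒below (part-tailClass m≤K px)
    cols : ∣ col (toℕ α) - col (toℕ β) ∣ ≤ 1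
    cols = subst₂ (λ c c′ → ∣ c - c′ ∣ ≤ 1) (proj₁ below-x) (proj₁ (tailClass⇒below (part-tailClass m≤K py))) (proj₂ near)
    rows : row (toℕ α) ≤ suc (row (toℕ β))
    rows with part-tailClass m≤K py
    ... | inj₁ y≡b = ≤-trans (proj₂ below-x)
                       (subst (λ r → row (toℕ x) ≤ suc r) (cong row y≡b) (∣-∣≤1⇒≤suc (row (toℕ x)) (row (toℕ y)) (proj₁ near)))
    ... | inj₂ (tailβ , _) = <+m⇒row≤suc (≤-trans (toℕ<n α) tailβ)

  tailStage-red-notTail : ∀ {k α β} → m ≤ suc k → quotient (part k) α β ≡ red → ¬ Tail (suc k) (toℕ α) →
                          toℕ β ∈ followingNeighbours (row (toℕ α)) (col (toℕ α))
  tailStage-red-notTail {k} {α} {β} m≤K isRed ¬tailα with quotient-red⇒ (part k) α β isRed | tailStage-red⇒tail m≤K isRed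
  ... | _ | inj₁ tailα = contradiction tailα ¬tailα
  ... | (_ , x , y , px , py , Gxy≡black) , _ | inj₂ tailβ =
    followingNeighbours-complete (+-cancelʳ-< m (toℕ α) (toℕ β) (≤-trans (≰⇒> ¬tailα) tailβ)) rows cols
    where
    near : Near (toℕ x) (toℕ y)
    near = King≡black⇒Near x y Gxy≡black
    x≡a : toℕ x ≡ toℕ α
    x≡a = tailClass-notTail ¬tailα (part-tailClass m≤K px)
    below-y : Below (toℕ β) (toℕ y)
    below-y = tailClass⇒below (part-tailClass m≤K py)
    cols : ∣ col (toℕ α) - col (toℕ β) ∣ ≤ 1
    cols = subst₂ (λ c c′ → ∣ c - c′ ∣ ≤ 1) (cong col x≡a) (proj₁ below-y) (proj₂ near)
    rows : row (toℕ β) ≤ suc (row (toℕ α))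
    rows = ≤-trans (proj₂ below-y)
             (subst (λ a → row (toℕ y) ≤ suc (row a)) x≡a
                    (∣-∣≤1⇒≤suc (row (toℕ y)) (row (toℕ x)) (∣-∣≤1-comm (row (toℕ x)) (row (toℕ y)) (proj₁ near))))

  columnStage-red : ∀ {k α β} → suc k ≤ m → quotient (part k) α β ≡ red → toℕ β ∈ suc (toℕ α) ∷ pred (toℕ α) ∷ []
  columnStage-red {k} {α} {β} K≤m isRed with quotient-red⇒ (part k) α β isRed
  ... | (α≢β , x , y , px , py , Gxy≡black) , _ =
    columnClass-neighbour (toℕ x) (toℕ y) (α≢β ∘ toℕ-injective) (toℕ<n α) (toℕ<n β)
      (part-columnClass K≤m px) (part-columnClass K≤m py) (proj₂ (King≡black⇒Near x y Gxy≡black))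

  part-redBounded : ∀ k → RedBounded 6 (quotient (part k))
  part-redBounded k α with m ≤? suc k
  ... | yes m≤K with suc k ≤? toℕ α + m
  ...   | yes tailα = filter-allFin-length≤ (suc k) (λ β → quotient (part k) α β ≟ₑ red) (precedingNeighbours (row (toℕ α)) (col (toℕ α)))
                        (λ β isRed → tailStage-red-tail m≤K isRed tailα)
  ...   | no ¬tailα = ≤-trans (filter-allFin-length≤ (suc k) (λ β → quotient (part k) α β ≟ₑ red) (followingNeighbours (row (toℕ α)) (col (toℕ α)))
                                 (λ β isRed → tailStage-red-notTail m≤K isRed ¬tailα))
                              (m≤m+n 4 2)
  part-redBounded k α | no m≰K =
    ≤-trans (filter-allFin-length≤ (suc k) (λ β → quotient (part k) α β ≟ₑ red) (suc (toℕ α) ∷ pred (toℕ α) ∷ [])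
               (λ β isRed → columnStage-red (<⇒≤ (≰⇒> m≰K)) isRed))
            (m≤m+n 2 4)

theorem1p5 : (n m : ℕ) → 0 < n → 0 < m → TwwAtMost (King n m) 7
theorem1p5 zero    _       ()
theorem1p5 (suc _) zero    _  ()
theorem1p5 (suc n′) (suc m′) _ _ =
  dsequence-of-partitions (King (suc n′) (suc m′)) (King-isGraph (suc n′) (suc m′)) 7
    part part-top part-step (λ k _ α → m≤n⇒m≤1+n (part-redBounded k α))
  where open KingPartitions n′ m′
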